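{- Let $G$ be a finite $\Sigma^\circ$-labeled graph. If an edge $e$ is included in a zone $Z$ of the zoning of $G$, then $t(e)$ is in-well-formed.
   Context: $\Sigma$ is a signature with arities $\#$; $\Sigma^\circ=(\Sigma\uplus\mathbb{N}^+)\uplus\{\bot,\top\}$ is the flat lattice; a $\Sigma^\circ$-labeled graph has vertices and edges labeled in $\Sigma^\circ$, with source and target maps $s,t$. A vertex $v$ is in-well-formed (I) if it has at most one incoming edge; it is out-well-formed (O) if its label $l$ lies in $\Sigma$ and $v$ has precisely $\#(l)$ outgoing edges, labeled $1,2,\ldots,\#(l)$. A vertex is good if it is O and all its children (targets of its outgoing edges) are I; otherwise it is bad. The zoning of $G$ is constructed iteratively: initially each vertex forms its own zone (a subgraph); repeatedly, if an edge $e$ is not included in any zone and $s(e)$ is good, the zones of $s(e)$ and $t(e)$ are joined along $e$ (if they are the same zone $Z$, $e$ is added to $Z$); stop when no such edge remains. -}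

module Defs where

open import Data.Nat using (ℕ)
open import Data.Fin using (Fin; toℕ; _≟_)
open import Data.Bool using (Bool; true; false)
open import Data.Product using (Σ; ∃; _×_; _,_)
open import Relation.Nullary using (¬_; yes; no)
open import Relation.Binary.PropositionalEquality using (_≡_)
open import Relation.Binary.Construct.Closure.ReflexiveTransitive using (Star)

record Signature : Set₁ where
  field
    Sym   : Set
    arity : Sym → ℕ
open Signature public

-- Σ° = (Σ ⊎ ℕ⁺) ⊎ {⊥, ⊤}  (the flat lattice; its order is not needed here).
-- Convention: `num k` denotes the positive natural number k + 1.
data Label (S : Signature) : Set where
  sym : Sym S → Label S
  num : ℕ → Label S
  bot : Label S
  top : Label S

record LGraph (S : Signature) : Set where
  field
    nV   : ℕ
    nE   : ℕ
    vlab : Fin nV → Label S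
    elab : Fin nE → Label S
    src  : Fin nE → Fin nV
    tgt  : Fin nE → Fin nV
open LGraph public

module _ {S : Signature} (G : LGraph S) where

  InWF : Fin (nV G) → Set
  InWF v = ∀ e e' → tgt G e ≡ v → tgt G e' ≡ v → e ≡ e'

  -- (O): label l ∈ Σ, and the outgoing edges are precisely #(l) edges
  -- labeled 1, …, #(l) (label i+1 is `num (toℕ i)` for i : Fin #(l)).
  OutWF : Fin (nV G) → Set
  OutWF v = Σ (Sym S) λ f → (vlab G v ≡ sym f)
    × (∀ e → src G e ≡ v → ∃ λ (i : Fin (arity S f)) → elab G e ≡ num (toℕ i))
    × (∀ (i : Fin (arity S f)) → ∃ λ e → src G e ≡ v × elab G e ≡ num (toℕ i))
    × (∀ e e' → src G e ≡ v → src G e' ≡ v → elab G e ≡ elab G e' → e ≡ e')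

  Good : Fin (nV G) → Set
  Good v = OutWF v × (∀ e → src G e ≡ v → InWF (tgt G e))

  -- State of the zoning construction: each vertex is mapped to a
  -- representative vertex naming its zone; `incl e ≡ true` iff edge e has
  -- been included in a zone (namely the zone of its endpoints).
  record ZState : Set where
    constructor zstate
    field
      zone : Fin (nV G) → Fin (nV G)
      incl : Fin (nE G) → Bool
  open ZState public

  initial : ZState
  initial = zstate (λ v → v) (λ _ → false)

  joinAlong : ZState → Fin (nE G) → ZState
  joinAlong st e = zstate newZone newIncl
    where
      newZone : Fin (nV G) → Fin (nV G)
      newZone v with zone st v ≟ zone st (tgt G e)
      ... | yes _ = zone st (src G e)
      ... | no  _ = zone st v
      newIncl : Fin (nE G) → Bool
      newIncl e' with e' ≟ e
      ... | yes _ = true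
      ... | no  _ = incl st e'

  data Step : ZState → ZState → Set where
    step : ∀ st e → incl st e ≡ false → Good (src G e) → Step st (joinAlong st e)

  Terminal : ZState → Set
  Terminal st = ∀ e → incl st e ≡ false → ¬ Good (src G e)

  IsZoning : ZState → Set
  IsZoning st = Star Step initial st × Terminal st

{-# OPTIONS --safe #-}
module Submission where

-- The construction only ever includes an edge whose source is good, and a good
-- vertex has in-well-formed children; so every included edge ends in an
-- in-well-formed vertex.

open import Defs
open import Data.Fin using (Fin; _≟_)
open import Data.Bool using (true)
open import Data.Product using (_,_; proj₂)
open import Relation.Nullary using (yes; no)
open import Relation.Binary.PropositionalEquality using (_≡_; refl)
open import Relation.Binary.Construct.Closure.ReflexiveTransitive using (Star; ε; _◅_)

module _ {S : Signature} (G : LGraph S) where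

  IncludedEdgesHaveGoodSource : ZState G → Set
  IncludedEdgesHaveGoodSource st = ∀ e → ZState.incl st e ≡ true → Good G (src G e)

  initial-includedEdgesHaveGoodSource : IncludedEdgesHaveGoodSource (initial G)
  initial-includedEdgesHaveGoodSource e ()

  step-preserves-includedEdgesHaveGoodSource : ∀ {st st′} → Step G st st′ →
    IncludedEdgesHaveGoodSource st → IncludedEdgesHaveGoodSource st′
  step-preserves-includedEdgesHaveGoodSource (step st e _ good) inv e′ included
    with e′ ≟ e
  ... | yes refl = good
  ... | no  _    = inv e′ included

  reachable-includedEdgesHaveGoodSource : ∀ {st} → Star (Step G) (initial G) st →
    IncludedEdgesHaveGoodSource st
  reachable-includedEdgesHaveGoodSource = go initial-includedEdgesHaveGoodSource
    where
    go : ∀ {st st′} → IncludedEdgesHaveGoodSource st → Star (Step G) st st′ →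
      IncludedEdgesHaveGoodSource st′
    go inv ε        = inv
    go inv (s ◅ ss) = go (step-preserves-includedEdgesHaveGoodSource s inv) ss

  good-source⇒target-inWF : ∀ e → Good G (src G e) → InWF G (tgt G e)
  good-source⇒target-inWF e (_ , childrenInWF) = childrenInWF e refl

proposition51 : (S : Signature) (G : LGraph S) (st : ZState G) → IsZoning G st
    → (e : Fin (nE G)) → ZState.incl st e ≡ true → InWF G (tgt G e)
proposition51 S G st (run , _) e included =
  good-source⇒target-inWF G e (reachable-includedEdgesHaveGoodSource G run e included)
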